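{- Let $y$ be produced by the segment construction described in the context. Consider two disjoint intervals $[u\oplus\ell]_{n-1}$ and $[v\oplus s]_{n-1}$ with $\ell+s\le c$. Then $$y([u\oplus\ell]_{n-1})+y([v\oplus s]_{n-1})\le y([u\oplus(\ell+s+1)]_{n-1}).$$
   Context: Let $k\ge2$ and $n>2^k$ be integers, $c=2^k-2$, with $\gcd(c,n-1)=1$, and let $V=\{0,\dots,n-1\}$. Let $h,w$ be the positive integers with $h(n-1)-wc=1$ and $0<w\le n-2$ minimal. Define $g(v)=v\cdot\frac{h}{wc}$ and $r=\lfloor c/h\rfloor$. Interval notation: for integers $a,b$ and $m\ge1$, $[a,b]_m=\{z\bmod m:a\le z\le b\}$ if $a\le b$ and $\emptyset$ otherwise, $[a,b]=[a,b]_n$, $[v\oplus\ell]_m=[v,v+\ell-1]_m$; $y(S)=\sum_{v\in S}y_v$. Segment construction of $y\in\mathbb R^V$: set $y_0=y_{n-1}=0$; starting with $v=1$, repeatedly let $r^*$ be the largest element of $\{r,r+1\}$ with $g(v+r^*-1)\le y([1,v-1])+\frac1w$ ($y([1,v-1])$ being the mass already assigned to $1,\dots,v-1$), set $y_i=\frac1{r^*w}$ for $i=v,\dots,v+r^*-1$, and set $v:=v+r^*$; stop when $v>n-2$. -}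

module Defs where

open import Data.Nat as ℕ using (ℕ; zero; suc; _+_; _*_; _∸_; _<ᵇ_)
open import Data.Bool using (Bool; true; false; if_then_else_; _∧_)
open import Data.List using (List; map; upTo; foldr)
open import Data.Bool.ListAction using (any)
open import Data.Integer using (+_)
open import Data.Rational as ℚ using (ℚ; 0ℚ; 1ℚ)
open import Data.Rational.Properties using (_≤?_)
open import Data.Nat.Base using (_≡ᵇ_)
open import Relation.Nullary.Decidable using (does)

-- a / b as a rational; the (never used) case b = 0 is given the value 0.
frac : ℕ → ℕ → ℚ
frac a zero    = 0ℚ
frac a (suc b) = (+ a) ℚ./ suc b

-- z mod m for natural z (m = 0 never occurs: the modulus is n-1 ≥ 1)
modN : ℕ → ℕ → ℕ
modN z zero    = z
modN z (suc m) = z ℕ.% suc m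

-- floor (a / b) (b = 0 never occurs)
divN : ℕ → ℕ → ℕ
divN a zero    = 0
divN a (suc b) = a ℕ./ suc b

range : ℕ → ℕ → List ℕ
range a len = map (λ i → a + i) (upTo len)

sumℚ : List ℚ → ℚ
sumℚ = foldr ℚ._+_ 0ℚ

-- membership of x in  [a ⊕ len]_m = { z mod m : a ≤ z ≤ a+len-1 }
inInterval : (m a len x : ℕ) → Bool
inInterval m a len x = any (λ z → modN z m ≡ᵇ x) (range a len)

-- y([a ⊕ len]_m) : sum of y_x over the SET [a ⊕ len]_m ⊆ {0,…,m-1}
yInterval : (y : ℕ → ℚ) (m a len : ℕ) → ℚ
yInterval y m a len =
  sumℚ (map (λ x → if inInterval m a len x then y x else 0ℚ) (upTo m))

g : (h w c v : ℕ) → ℚ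
g h w c v = frac (v * h) (w * c)

rOf : (h c : ℕ) → ℕ
rOf h c = divN c h

segLoop : (n h w c : ℕ) → (fuel v : ℕ) → (ℕ → ℚ) → (ℕ → ℚ)
segLoop n h w c zero v y = y
segLoop n h w c (suc fuel) v y =
  if (n ∸ 2) <ᵇ v then y else segLoop n h w c fuel (v + rstar) y'
  where
    r : ℕ
    r = rOf h c
    mass : ℚ
    mass = sumℚ (map y (range 1 (v ∸ 1)))
    rstar : ℕ
    rstar = if does (g h w c (v + (suc r) ∸ 1) ≤? (mass ℚ.+ frac 1 w))
            then suc r else r
    y' : ℕ → ℚ
    y' i = if (v ℕ.≤ᵇ i) ∧ (i <ᵇ (v + rstar)) ∧ (i <ᵇ n)
           then frac 1 (rstar * w) else y i

-- The vector y produced by the segment construction: start from y ≡ 0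
-- (in particular y_0 = y_{n-1} = 0) at v = 1.  Each step advances v by
-- r* ≥ r ≥ 1, so n steps of fuel suffice for the loop to stop.
segY : (n h w c : ℕ) → ℕ → ℚ
segY n h w c = segLoop n h w c n 1 (λ _ → 0ℚ)

module Submission where

-- Scale y by R w, where r = ⌊c/h⌋ and R = r (r + 1). The j-th segment (b j, b (j + 1)],
-- b j = ⌊j c / h⌋, has r or r + 1 points, each of integer weight R / (its length), so the
-- scaled prefix mass Ω is R j at b j and linear in between. The Beatty-type bounds
-- b i + b j ≤ b (i + j) ≤ b i + b j + 1 then make Ω subadditive, Ω (x + t) ≤ Ω x + Ω t, and
-- almost superadditive, Ω x + Ω t ≤ Ω (x + t + 1). Because h (n − 1) = w c + 1 the segments
-- are symmetric under x ↦ n − 1 − x, so a cyclic window of length s has mass at most Ω s,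
-- and one of length s + 1 at least Ω s. Hence y([v ⊕ s]) ≤ Ω s / (R w) ≤ y([u + ℓ ⊕ (s + 1)]),
-- and adding y([u ⊕ ℓ]) gives the claim.

open import Defs
open import Data.Nat using (ℕ; _+_; _*_; _∸_; _^_; _≤_; _<_)
open import Data.Nat.Coprimality using (Coprime)
open import Data.Rational using () renaming (_+_ to _+q_; _≤_ to _≤q_)
open import Data.Product using (_×_)
open import Relation.Binary.PropositionalEquality using (_≡_)
open import Relation.Nullary using (¬_)
open import Data.Bool using (true)

open import Data.Nat using (zero; suc; pred; z≤n; s≤s; z<s; NonZero; >-nonZero; >-nonZero⁻¹; _≤ᵇ_; _<ᵇ_; _≡ᵇ_)
open import Data.Nat.Properties
open import Algebra.Properties.CommutativeSemigroup +-commutativeSemigroup using () renaming (interchange to +-interchange)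
open import Data.Nat.DivMod
open import Data.Nat.Tactic.RingSolver using (solve; solve-∀)
open import Data.Integer as ℤ using (ℤ)
import Data.Integer.Properties as ℤ
import Data.Integer.Tactic.RingSolver as ℤ-Solver
open import Data.Rational as ℚ using (ℚ; 0ℚ; toℚᵘ; fromℚᵘ)
import Data.Rational.Properties as ℚ
open import Data.Rational.Unnormalised as ℚᵘ using (mkℚᵘ; *≡*; *≤*)
import Data.Rational.Unnormalised.Properties as ℚᵘ
open import Data.Bool using (Bool; false; if_then_else_; _∨_; _∧_)
import Data.Bool.Properties as Bool
open import Data.Bool.ListAction using (any)
open import Data.List using (_∷_; []; map; upTo; applyUpTo)
open import Data.List.Properties using (map-applyUpTo; map-upTo; map-∘)
open import Data.Product using (_,_; ∃-syntax; proj₁; proj₂)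
open import Data.Sum using (_⊎_; inj₁; inj₂)
open import Data.Empty using (⊥-elim)
open import Function using (_∘_)
open import Relation.Binary.PropositionalEquality using (refl; sym; trans; cong; cong₂; subst; subst₂; _≢_; module ≡-Reasoning)
open import Relation.Binary.Definitions using (tri<; tri≈; tri>)
open import Relation.Nullary using (Dec; yes; no; does)
open import Relation.Nullary.Decidable using (dec-true; dec-false)

m*n≤o⇒m≤o/n : ∀ {m o} n .{{_ : NonZero n}} → m * n ≤ o → m ≤ o / n
m*n≤o⇒m≤o/n {m} {o} n le = subst (_≤ o / n) (m*n/n≡m m n) (/-monoˡ-≤ n le)

m≤o/n⇒m*n≤o : ∀ {m o} n .{{_ : NonZero n}} → m ≤ o / n → m * n ≤ o
m≤o/n⇒m*n≤o {m} {o} n le = ≤-trans (*-monoˡ-≤ n le) (m/n*n≤m o n)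

m<[1+m/n]*n : ∀ m n .{{_ : NonZero n}} → m < suc (m / n) * n
m<[1+m/n]*n m n = begin-strict
  m                   ≡⟨ m≡m%n+[m/n]*n m n ⟩
  m % n + (m / n) * n <⟨ +-monoˡ-< ((m / n) * n) (m%n<n m n) ⟩
  suc (m / n) * n     ∎
  where open ≤-Reasoning

m*n+o≡p*n⇒1+m≡p : ∀ m n o p → m * n + o ≡ p * n → 0 < o → o < n + n → suc m ≡ p
m*n+o≡p*n⇒1+m≡p m n o p eq o>0 o<2n with <-cmp (suc m) p
... | tri≈ _ e _ = e
... | tri< lt _ _ = ⊥-elim (<⇒≱ o<2n (+-cancelˡ-≤ (m * n) _ _ (begin
      m * n + (n + n)     ≡⟨ solve (m ∷ n ∷ []) ⟩
      suc (suc m) * n     ≤⟨ *-monoˡ-≤ n lt ⟩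
      p * n               ≡⟨ sym eq ⟩
      m * n + o           ∎)))
  where open ≤-Reasoning
... | tri> _ _ gt = ⊥-elim (<-irrefl refl (begin-strict
      p * n               ≤⟨ *-monoˡ-≤ n (≤-pred gt) ⟩
      m * n               <⟨ m<m+n (m * n) o>0 ⟩
      m * n + o           ≡⟨ eq ⟩
      p * n               ∎))
  where open ≤-Reasoning

-- Convexity estimates for adding two positions whose offsets carry weights A and B: the sum
-- stays in segment i + j when A + B ≤ R and carries into segment i + j + 1 otherwise.
no-carry-upper : ∀ {R} A B E p q Lp Lq K Lk → A + B + E ≡ R →
  p + q ≤ K → p + Lp + q ≤ K + Lk → p + (q + Lq) ≤ K + Lk →
  R * p + A * Lp + (R * q + B * Lq) ≤ R * K + (A + B) * Lk
no-carry-upper A B E p q Lp Lq K Lk refl h₁ h₂ h₃ = begin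
  (A + B + E) * p + A * Lp + ((A + B + E) * q + B * Lq)
    ≡⟨ solve (A ∷ B ∷ E ∷ p ∷ q ∷ Lp ∷ Lq ∷ []) ⟩
  E * (p + q) + A * (p + Lp + q) + B * (p + (q + Lq))
    ≤⟨ +-mono-≤ (+-mono-≤ (*-monoʳ-≤ E h₁) (*-monoʳ-≤ A h₂)) (*-monoʳ-≤ B h₃) ⟩
  E * K + A * (K + Lk) + B * (K + Lk)
    ≡⟨ solve (A ∷ B ∷ E ∷ K ∷ Lk ∷ []) ⟩
  (A + B + E) * K + (A + B) * Lk ∎
  where open ≤-Reasoning

no-carry-lower : ∀ {R} A B E p q Lp Lq K Lk → A + B + E ≡ R →
  K ≤ suc (p + q) → K + Lk ≤ suc (p + Lp + q) → K + Lk ≤ suc (p + (q + Lq)) →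
  R * K + (A + B) * Lk ≤ R + (R * p + A * Lp + (R * q + B * Lq))
no-carry-lower A B E p q Lp Lq K Lk refl h₁ h₂ h₃ = begin
  (A + B + E) * K + (A + B) * Lk
    ≡⟨ solve (A ∷ B ∷ E ∷ K ∷ Lk ∷ []) ⟩
  E * K + A * (K + Lk) + B * (K + Lk)
    ≤⟨ +-mono-≤ (+-mono-≤ (*-monoʳ-≤ E h₁) (*-monoʳ-≤ A h₂)) (*-monoʳ-≤ B h₃) ⟩
  E * suc (p + q) + A * suc (p + Lp + q) + B * suc (p + (q + Lq))
    ≡⟨ solve (A ∷ B ∷ E ∷ p ∷ q ∷ Lp ∷ Lq ∷ []) ⟩
  (A + B + E) + ((A + B + E) * p + A * Lp + ((A + B + E) * q + B * Lq)) ∎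
  where open ≤-Reasoning

carry-upper : ∀ {R A B} A′ B′ E p q Lp Lq K Lk → R ≡ A′ + B′ + E → A ≡ B′ + E → B ≡ A′ + E →
  p + (q + Lq) ≤ K → p + Lp + q ≤ K → p + Lp + (q + Lq) ≤ K + Lk →
  R * p + A * Lp + (R * q + B * Lq) ≤ R * K + E * Lk
carry-upper A′ B′ E p q Lp Lq K Lk refl refl refl h₁ h₂ h₃ = begin
  (A′ + B′ + E) * p + (B′ + E) * Lp + ((A′ + B′ + E) * q + (A′ + E) * Lq)
    ≡⟨ solve (A′ ∷ B′ ∷ E ∷ p ∷ q ∷ Lp ∷ Lq ∷ []) ⟩
  A′ * (p + (q + Lq)) + B′ * (p + Lp + q) + E * (p + Lp + (q + Lq))
    ≤⟨ +-mono-≤ (+-mono-≤ (*-monoʳ-≤ A′ h₁) (*-monoʳ-≤ B′ h₂)) (*-monoʳ-≤ E h₃) ⟩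
  A′ * K + B′ * K + E * (K + Lk)
    ≡⟨ solve (A′ ∷ B′ ∷ E ∷ K ∷ Lk ∷ []) ⟩
  (A′ + B′ + E) * K + E * Lk ∎
  where open ≤-Reasoning

carry-lower : ∀ {R A B} A′ B′ E p q Lp Lq K Lk → R ≡ A′ + B′ + E → A ≡ B′ + E → B ≡ A′ + E →
  K ≤ suc (p + (q + Lq)) → K ≤ suc (p + Lp + q) → K + Lk ≤ suc (p + Lp + (q + Lq)) →
  R * K + E * Lk ≤ R + (R * p + A * Lp + (R * q + B * Lq))
carry-lower A′ B′ E p q Lp Lq K Lk refl refl refl h₁ h₂ h₃ = begin
  (A′ + B′ + E) * K + E * Lk
    ≡⟨ solve (A′ ∷ B′ ∷ E ∷ K ∷ Lk ∷ []) ⟩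
  A′ * K + B′ * K + E * (K + Lk)
    ≤⟨ +-mono-≤ (+-mono-≤ (*-monoʳ-≤ A′ h₁) (*-monoʳ-≤ B′ h₂)) (*-monoʳ-≤ E h₃) ⟩
  A′ * suc (p + (q + Lq)) + B′ * suc (p + Lp + q) + E * suc (p + Lp + (q + Lq))
    ≡⟨ solve (A′ ∷ B′ ∷ E ∷ p ∷ q ∷ Lp ∷ Lq ∷ []) ⟩
  (A′ + B′ + E) + ((A′ + B′ + E) * p + (B′ + E) * Lp + ((A′ + B′ + E) * q + (A′ + E) * Lq)) ∎
  where open ≤-Reasoning

no-carry-sum : ∀ R A B i j → R * (i + j) + (A + B) ≡ (R * i + A) + (R * j + B)
no-carry-sum R A B i j = solve (R ∷ A ∷ B ∷ i ∷ j ∷ [])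

carry-sum : ∀ {R A B} A′ B′ E i j → R ≡ A′ + B′ + E → A ≡ B′ + E → B ≡ A′ + E →
  R * suc (i + j) + E ≡ (R * i + A) + (R * j + B)
carry-sum A′ B′ E i j refl refl refl = solve (A′ ∷ B′ ∷ E ∷ i ∷ j ∷ [])

carry-split : ∀ {A B R} → A ≤ R → B ≤ R → R ≤ A + B →
  ∃[ A′ ] ∃[ B′ ] ∃[ E ] (R ≡ A′ + B′ + E × A ≡ B′ + E × B ≡ A′ + E)
carry-split {A} {B} {R} A≤R B≤R R≤A+B with m≤n⇒∃[o]m+o≡n A≤R | m≤n⇒∃[o]m+o≡n B≤R | m≤n⇒∃[o]m+o≡n R≤A+B
... | A′ , A+A′≡R | B′ , B+B′≡R | E , R+E≡A+B = A′ , B′ , E , R≡ , A≡ , B≡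
  where
    open ≡-Reasoning
    A≡ : A ≡ B′ + E
    A≡ = +-cancelˡ-≡ B _ _ (begin
      B + A          ≡⟨ +-comm B A ⟩
      A + B          ≡⟨ R+E≡A+B ⟨
      R + E          ≡⟨ cong (_+ E) B+B′≡R ⟨
      B + B′ + E     ≡⟨ +-assoc B B′ E ⟩
      B + (B′ + E)   ∎)
    B≡ : B ≡ A′ + E
    B≡ = +-cancelˡ-≡ A _ _ (begin
      A + B          ≡⟨ R+E≡A+B ⟨
      R + E          ≡⟨ cong (_+ E) A+A′≡R ⟨
      A + A′ + E     ≡⟨ +-assoc A A′ E ⟩
      A + (A′ + E)   ∎)
    R≡ : R ≡ A′ + B′ + E
    R≡ = begin
      R              ≡⟨ A+A′≡R ⟨
      A + A′         ≡⟨ cong (_+ A′) A≡ ⟩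
      B′ + E + A′    ≡⟨ solve (A′ ∷ B′ ∷ E ∷ []) ⟩
      A′ + B′ + E    ∎

module Boundaries (c h : ℕ) .{{_ : NonZero h}} where

  -- Segment j of the construction is (b j, b (j + 1)].
  b : ℕ → ℕ
  b j = j * c / h

  r : ℕ
  r = c / h

  R : ℕ
  R = r * suc r

  b-mono : ∀ {i j} → i ≤ j → b i ≤ b j
  b-mono le = /-monoˡ-≤ h (*-monoˡ-≤ c le)

  b-superadditive : ∀ i j → b i + b j ≤ b (i + j)
  b-superadditive i j = m*n≤o⇒m≤o/n h (begin
    (b i + b j) * h      ≡⟨ *-distribʳ-+ h (b i) (b j) ⟩
    b i * h + b j * h    ≤⟨ +-mono-≤ (m/n*n≤m (i * c) h) (m/n*n≤m (j * c) h) ⟩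
    i * c + j * c        ≡⟨ *-distribʳ-+ c i j ⟨
    (i + j) * c          ∎)
    where open ≤-Reasoning

  b-subadditive : ∀ i j → b (i + j) ≤ suc (b i + b j)
  b-subadditive i j = ≤-pred (m<n*o⇒m/o<n (begin-strict
    (i + j) * c                       ≡⟨ *-distribʳ-+ c i j ⟩
    i * c + j * c                     <⟨ +-mono-< (m<[1+m/n]*n (i * c) h) (m<[1+m/n]*n (j * c) h) ⟩
    suc (b i) * h + suc (b j) * h     ≡⟨ *-distribʳ-+ h (suc (b i)) (suc (b j)) ⟨
    (suc (b i) + suc (b j)) * h       ≡⟨ cong (_* h) (cong suc (+-suc (b i) (b j))) ⟩
    suc (suc (b i + b j)) * h         ∎))
    where open ≤-Reasoning

  len : ℕ → ℕ
  len j = b (suc j) ∸ b j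

  b-suc : ∀ j → b (suc j) ≡ b j + len j
  b-suc j = sym (m+[n∸m]≡n (b-mono (n≤1+n j)))

  b1≡r : b 1 ≡ r
  b1≡r = cong (_/ h) (+-identityʳ c)

  r≤len : ∀ j → r ≤ len j
  r≤len j = +-cancelˡ-≤ (b j) _ _ (begin
    b j + r               ≡⟨ cong (b j +_) b1≡r ⟨
    b j + b 1             ≤⟨ b-superadditive j 1 ⟩
    b (j + 1)             ≡⟨ cong b (+-comm j 1) ⟩
    b (suc j)             ≡⟨ b-suc j ⟩
    b j + len j           ∎)
    where open ≤-Reasoning

  len≤1+r : ∀ j → len j ≤ suc r
  len≤1+r j = +-cancelˡ-≤ (b j) _ _ (begin
    b j + len j           ≡⟨ b-suc j ⟨
    b (suc j)             ≡⟨ cong b (+-comm j 1) ⟨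
    b (j + 1)             ≤⟨ b-subadditive j 1 ⟩
    suc (b j + b 1)       ≡⟨ cong (λ z → suc (b j + z)) b1≡r ⟩
    suc (b j + r)         ≡⟨ +-suc (b j) r ⟨
    b j + suc r           ∎)
    where open ≤-Reasoning

  len≡r⊎1+r : ∀ j → len j ≡ r ⊎ len j ≡ suc r
  len≡r⊎1+r j with m≤n⇒m<n∨m≡n (len≤1+r j)
  ... | inj₁ lt = inj₁ (≤-antisym (≤-pred lt) (r≤len j))
  ... | inj₂ e  = inj₂ e

  weight : ℕ → ℕ
  weight j = r + suc r ∸ len j

  len*weight≡R : ∀ j → len j * weight j ≡ R
  len*weight≡R j with len≡r⊎1+r j
  ... | inj₁ e rewrite e = cong (r *_) (m+n∸m≡n r (suc r))
  ... | inj₂ e rewrite e = trans (cong (suc r *_) (m+n∸n≡m r (suc r))) (*-comm (suc r) r)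

  b-superadditive-sucˡ : ∀ i j → b i + len i + b j ≤ b (suc (i + j))
  b-superadditive-sucˡ i j = subst (λ z → z + b j ≤ b (suc (i + j))) (b-suc i) (b-superadditive (suc i) j)

  b-superadditive-sucʳ : ∀ i j → b i + (b j + len j) ≤ b (suc (i + j))
  b-superadditive-sucʳ i j = subst₂ (λ z k → b i + z ≤ b k) (b-suc j) (+-suc i j) (b-superadditive i (suc j))

  b-superadditive-suc² : ∀ i j → b i + len i + (b j + len j) ≤ b (suc (suc (i + j)))
  b-superadditive-suc² i j = subst₂ (λ z k → z ≤ b (suc k)) (cong₂ _+_ (b-suc i) (b-suc j)) (+-suc i j)
    (b-superadditive (suc i) (suc j))

  b-subadditive-sucˡ : ∀ i j → b (suc (i + j)) ≤ suc (b i + len i + b j)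
  b-subadditive-sucˡ i j = subst (λ z → b (suc (i + j)) ≤ suc (z + b j)) (b-suc i) (b-subadditive (suc i) j)

  b-subadditive-sucʳ : ∀ i j → b (suc (i + j)) ≤ suc (b i + (b j + len j))
  b-subadditive-sucʳ i j = subst₂ (λ z k → b k ≤ suc (b i + z)) (b-suc j) (+-suc i j) (b-subadditive i (suc j))

  b-subadditive-suc² : ∀ i j → b (suc (suc (i + j))) ≤ suc (b i + len i + (b j + len j))
  b-subadditive-suc² i j = subst₂ (λ z k → b (suc k) ≤ suc z) (cong₂ _+_ (b-suc i) (b-suc j)) (+-suc i j)
    (b-subadditive (suc i) (suc j))

  module _ .{{_ : NonZero c}} where

    -- x lies in segment j iff j c < x h ≤ (j + 1) c.
    segment : ℕ → ℕ
    segment x = pred (x * h) / c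

    segment-unique : ∀ j {x} → b j < x → x ≤ b (suc j) → segment x ≡ j
    segment-unique j {x} lo hi = ≤-antisym
      (≤-pred (m<n*o⇒m/o<n (subst (_≤ suc j * c) (sym (suc-pred (x * h) {{>-nonZero x*h>0}})) (m≤o/n⇒m*n≤o h hi))))
      (m*n≤o⇒m≤o/n c (<⇒≤pred jc<xh))
      where
        jc<xh : j * c < x * h
        jc<xh = ≰⇒> (λ xh≤jc → <⇒≱ lo (m*n≤o⇒m≤o/n h xh≤jc))
        x*h>0 : 0 < x * h
        x*h>0 = <-≤-trans z<s jc<xh

    segment-bounds : ∀ x → let j = segment (suc x) in b j < suc x × suc x ≤ b (suc j)
    segment-bounds x = lo , hi
      where
        N = pred (suc x * h)
        j = N / c
        1+N≡xh : suc N ≡ suc x * h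
        1+N≡xh = suc-pred (suc x * h) {{m*n≢0 (suc x) h}}
        lo : b j < suc x
        lo = ≰⇒> (λ x≤bj → <-irrefl refl (begin-strict
          N            <⟨ n<1+n N ⟩
          suc N        ≡⟨ 1+N≡xh ⟩
          suc x * h    ≤⟨ m≤o/n⇒m*n≤o h x≤bj ⟩
          j * c        ≤⟨ m/n*n≤m N c ⟩
          N            ∎))
          where open ≤-Reasoning
        hi : suc x ≤ b (suc j)
        hi = m*n≤o⇒m≤o/n h (subst (_≤ suc j * c) 1+N≡xh (m<[1+m/n]*n N c))

    -- ω x = R w y_x and Ω X = R w y([1, X]) for the constructed y (segY-agrees).
    ω : ℕ → ℕ
    ω zero    = 0
    ω (suc x) = weight (segment (suc x))

    Ω : ℕ → ℕ
    Ω zero    = 0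
    Ω (suc x) = Ω x + ω (suc x)

    ω-segment : ∀ j {x} → b j < x → x ≤ b (suc j) → ω x ≡ weight j
    ω-segment j {suc x} lo hi = cong weight (segment-unique j lo hi)

    Ω-mono : ∀ {x y} → x ≤ y → Ω x ≤ Ω y
    Ω-mono {y = zero} z≤n = z≤n
    Ω-mono {x} {suc y} x≤1+y with m≤n⇒m<n∨m≡n x≤1+y
    ... | inj₁ x<1+y = ≤-trans (Ω-mono (≤-pred x<1+y)) (m≤m+n (Ω y) _)
    ... | inj₂ refl  = ≤-refl

    Ω-boundary : ∀ j → Ω (b j) ≡ R * j
    Ω-within : ∀ j δ → δ ≤ len j → Ω (b j + δ) ≡ R * j + δ * weight j

    Ω-boundary zero = trans (cong Ω (0/n≡0 h)) (sym (*-zeroʳ R))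
    Ω-boundary (suc j) = begin
      Ω (b (suc j))            ≡⟨ cong Ω (b-suc j) ⟩
      Ω (b j + len j)          ≡⟨ Ω-within j (len j) ≤-refl ⟩
      R * j + len j * weight j ≡⟨ cong (R * j +_) (len*weight≡R j) ⟩
      R * j + R                ≡⟨ +-comm (R * j) R ⟩
      R + R * j                ≡⟨ *-suc R j ⟨
      R * suc j                ∎
      where open ≡-Reasoning

    Ω-within j zero _ = trans (cong Ω (+-identityʳ (b j))) (trans (Ω-boundary j) (sym (+-identityʳ (R * j))))
    Ω-within j (suc δ) 1+δ≤len = begin
      Ω (b j + suc δ)                          ≡⟨ cong Ω (+-suc (b j) δ) ⟩
      Ω (b j + δ) + ω (suc (b j + δ))          ≡⟨ cong₂ _+_ (Ω-within j δ (<⇒≤ 1+δ≤len)) (ω-segment j lo hi) ⟩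
      R * j + δ * weight j + weight j          ≡⟨ +-assoc (R * j) _ _ ⟩
      R * j + (δ * weight j + weight j)        ≡⟨ cong (R * j +_) (+-comm (δ * weight j) _) ⟩
      R * j + suc δ * weight j                 ∎
      where
        open ≡-Reasoning
        lo : b j < suc (b j + δ)
        lo = s≤s (m≤m+n (b j) δ)
        hi : suc (b j + δ) ≤ b (suc j)
        hi = subst (suc (b j + δ) ≤_) (sym (b-suc j))
               (subst (_≤ b j + len j) (+-suc (b j) δ) (+-monoʳ-≤ (b j) 1+δ≤len))

    record Position (x : ℕ) : Set where
      field
        index     : ℕ
        offset    : ℕ
        offset≤len : offset ≤ len index
        b+offset≡x : b index + offset ≡ x

    position : ∀ x → Position x
    position zero    = record { index = 0 ; offset = 0 ; offset≤len = z≤n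
                              ; b+offset≡x = trans (+-identityʳ (b 0)) (0/n≡0 h) }
    position (suc x) = record { index = j ; offset = suc x ∸ b j
                              ; offset≤len = ∸-monoˡ-≤ (b j) hi
                              ; b+offset≡x = m+[n∸m]≡n (<⇒≤ lo) }
      where
        j = segment (suc x)
        lo = proj₁ (segment-bounds x)
        hi = proj₂ (segment-bounds x)

    module _ (r>0 : 0 < r) where

      instance
        R≢0 : NonZero R
        R≢0 = m*n≢0 r (suc r) {{>-nonZero r>0}}

      len>0 : ∀ j → 0 < len j
      len>0 j = <-≤-trans r>0 (r≤len j)

      δ*weight*len≡R*δ : ∀ δ j → δ * weight j * len j ≡ R * δ
      δ*weight*len≡R*δ δ j = begin
        δ * weight j * len j     ≡⟨ *-assoc δ (weight j) (len j) ⟩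
        δ * (weight j * len j)   ≡⟨ cong (δ *_) (trans (*-comm (weight j) (len j)) (len*weight≡R j)) ⟩
        δ * R                    ≡⟨ *-comm δ R ⟩
        R * δ                    ∎
        where open ≡-Reasoning

      δ*weight≤R : ∀ δ j → δ ≤ len j → δ * weight j ≤ R
      δ*weight≤R δ j δ≤len = ≤-trans (*-monoˡ-≤ (weight j) δ≤len) (≤-reflexive (len*weight≡R j))

      R*[b+δ] : ∀ j δ → R * (b j + δ) ≡ R * b j + δ * weight j * len j
      R*[b+δ] j δ = trans (*-distribˡ-+ R (b j) δ) (cong (R * b j +_) (sym (δ*weight*len≡R*δ δ j)))

      -- Ω interpolates the points (b k, R k) linearly: in segment k it gains R / len k per step.
      Ω-upper-bound : ∀ k X S → R * X ≤ R * b k + S * len k → S ≤ R → Ω X ≤ R * k + S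
      Ω-upper-bound k X S RX≤ S≤R with X ≤? b k
      ... | yes X≤bk = ≤-trans (Ω-mono X≤bk) (≤-trans (≤-reflexive (Ω-boundary k)) (m≤m+n (R * k) S))
      ... | no X≰bk = begin
        Ω X                     ≡⟨ cong Ω b+δ≡X ⟨
        Ω (b k + δ)             ≡⟨ Ω-within k δ δ≤len ⟩
        R * k + δ * weight k    ≤⟨ +-monoʳ-≤ (R * k) (*-cancelʳ-≤ (δ * weight k) S (len k) {{>-nonZero (len>0 k)}}
                                     (≤-trans (≤-reflexive (δ*weight*len≡R*δ δ k)) Rδ≤)) ⟩
        R * k + S               ∎
        where
          open ≤-Reasoning
          δ = X ∸ b k
          b+δ≡X : b k + δ ≡ X
          b+δ≡X = m+[n∸m]≡n (<⇒≤ (≰⇒> X≰bk))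
          Rδ≤ : R * δ ≤ S * len k
          Rδ≤ = +-cancelˡ-≤ (R * b k) _ _ (begin
            R * b k + R * δ     ≡⟨ *-distribˡ-+ R (b k) δ ⟨
            R * (b k + δ)       ≡⟨ cong (R *_) b+δ≡X ⟩
            R * X               ≤⟨ RX≤ ⟩
            R * b k + S * len k ∎)
          δ≤len : δ ≤ len k
          δ≤len = *-cancelˡ-≤ R (≤-trans Rδ≤ (*-monoˡ-≤ (len k) S≤R))

      Ω-lower-bound : ∀ k X S → R * b k + S * len k ≤ R * X → S ≤ R → R * k + S ≤ Ω X
      Ω-lower-bound k X S ≤RX S≤R = subst (λ Y → R * k + S ≤ Ω Y) b+δ≡X (from-offset (δ ≤? len k))
        where
          open ≤-Reasoning
          δ = X ∸ b k
          b+δ≡X : b k + δ ≡ X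
          b+δ≡X = m+[n∸m]≡n (*-cancelˡ-≤ R (≤-trans (m≤m+n (R * b k) (S * len k)) ≤RX))
          S*len≤ : S * len k ≤ R * δ
          S*len≤ = +-cancelˡ-≤ (R * b k) _ _ (begin
            R * b k + S * len k ≤⟨ ≤RX ⟩
            R * X               ≡⟨ cong (R *_) b+δ≡X ⟨
            R * (b k + δ)       ≡⟨ *-distribˡ-+ R (b k) δ ⟩
            R * b k + R * δ     ∎)
          from-offset : Dec (δ ≤ len k) → R * k + S ≤ Ω (b k + δ)
          from-offset (yes δ≤len) = begin
            R * k + S               ≤⟨ +-monoʳ-≤ (R * k) (*-cancelʳ-≤ S (δ * weight k) (len k) {{>-nonZero (len>0 k)}}
                                         (≤-trans S*len≤ (≤-reflexive (sym (δ*weight*len≡R*δ δ k))))) ⟩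
            R * k + δ * weight k    ≡⟨ Ω-within k δ δ≤len ⟨
            Ω (b k + δ)             ∎
          from-offset (no δ≰len) = begin
            R * k + S               ≤⟨ +-monoʳ-≤ (R * k) S≤R ⟩
            R * k + R               ≡⟨ trans (+-comm (R * k) R) (sym (*-suc R k)) ⟩
            R * suc k               ≡⟨ Ω-boundary (suc k) ⟨
            Ω (b (suc k))           ≤⟨ Ω-mono (subst (_≤ b k + δ) (sym (b-suc k)) (+-monoʳ-≤ (b k) (<⇒≤ (≰⇒> δ≰len)))) ⟩
            Ω (b k + δ)             ∎

      Ω-subadditive-by-position : ∀ i α j β → α ≤ len i → β ≤ len j →
        Ω ((b i + α) + (b j + β)) ≤ Ω (b i + α) + Ω (b j + β)
      Ω-subadditive-by-position i α j β α≤len β≤len = by-carry (A + B ≤? R)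
        where
          open ≤-Reasoning
          A = α * weight i
          B = β * weight j
          k = i + j
          R*sum : R * ((b i + α) + (b j + β)) ≡ R * b i + A * len i + (R * b j + B * len j)
          R*sum = trans (*-distribˡ-+ R (b i + α) (b j + β)) (cong₂ _+_ (R*[b+δ] i α) (R*[b+δ] j β))
          Ω-sum : (R * i + A) + (R * j + B) ≡ Ω (b i + α) + Ω (b j + β)
          Ω-sum = sym (cong₂ _+_ (Ω-within i α α≤len) (Ω-within j β β≤len))
          by-carry : Dec (A + B ≤ R) → Ω ((b i + α) + (b j + β)) ≤ Ω (b i + α) + Ω (b j + β)
          by-carry (yes A+B≤R) = begin
            Ω ((b i + α) + (b j + β))     ≤⟨ Ω-upper-bound k _ (A + B) (subst (_≤ R * b k + (A + B) * len k) (sym R*sum)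
                                               (no-carry-upper A B (R ∸ (A + B)) (b i) (b j) (len i) (len j) (b k) (len k)
                                                 (m+[n∸m]≡n A+B≤R) (b-superadditive i j)
                                                 (≤-trans (b-superadditive-sucˡ i j) (≤-reflexive (b-suc k)))
                                                 (≤-trans (b-superadditive-sucʳ i j) (≤-reflexive (b-suc k))))) A+B≤R ⟩
            R * k + (A + B)               ≡⟨ no-carry-sum R A B i j ⟩
            (R * i + A) + (R * j + B)     ≡⟨ Ω-sum ⟩
            Ω (b i + α) + Ω (b j + β)     ∎
          by-carry (no A+B≰R) with carry-split (δ*weight≤R α i α≤len) (δ*weight≤R β j β≤len) (<⇒≤ (≰⇒> A+B≰R))
          ... | A′ , B′ , E , eR , eA , eB = begin
            Ω ((b i + α) + (b j + β))     ≤⟨ Ω-upper-bound (suc k) _ E (subst (_≤ R * b (suc k) + E * len (suc k)) (sym R*sum)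
                                               (carry-upper A′ B′ E (b i) (b j) (len i) (len j) (b (suc k)) (len (suc k)) eR eA eB
                                                 (b-superadditive-sucʳ i j) (b-superadditive-sucˡ i j)
                                                 (≤-trans (b-superadditive-suc² i j) (≤-reflexive (b-suc (suc k))))))
                                               (subst (E ≤_) (sym eR) (m≤n+m E (A′ + B′))) ⟩
            R * suc k + E                 ≡⟨ carry-sum A′ B′ E i j eR eA eB ⟩
            (R * i + A) + (R * j + B)     ≡⟨ Ω-sum ⟩
            Ω (b i + α) + Ω (b j + β)     ∎

      Ω-superadditive-by-position : ∀ i α j β → α ≤ len i → β ≤ len j →
        Ω (b i + α) + Ω (b j + β) ≤ Ω (suc ((b i + α) + (b j + β)))
      Ω-superadditive-by-position i α j β α≤len β≤len = by-carry (A + B ≤? R)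
        where
          open ≤-Reasoning
          A = α * weight i
          B = β * weight j
          k = i + j
          R*suc-sum : R + (R * b i + A * len i + (R * b j + B * len j)) ≡ R * suc ((b i + α) + (b j + β))
          R*suc-sum = trans (cong (R +_) (sym (trans (*-distribˡ-+ R (b i + α) (b j + β)) (cong₂ _+_ (R*[b+δ] i α) (R*[b+δ] j β)))))
                            (sym (*-suc R _))
          Ω-sum : Ω (b i + α) + Ω (b j + β) ≡ (R * i + A) + (R * j + B)
          Ω-sum = cong₂ _+_ (Ω-within i α α≤len) (Ω-within j β β≤len)
          by-carry : Dec (A + B ≤ R) → Ω (b i + α) + Ω (b j + β) ≤ Ω (suc ((b i + α) + (b j + β)))
          by-carry (yes A+B≤R) = begin
            Ω (b i + α) + Ω (b j + β)     ≡⟨ Ω-sum ⟩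
            (R * i + A) + (R * j + B)     ≡⟨ no-carry-sum R A B i j ⟨
            R * k + (A + B)               ≤⟨ Ω-lower-bound k _ (A + B) (subst (R * b k + (A + B) * len k ≤_) R*suc-sum
                                               (no-carry-lower A B (R ∸ (A + B)) (b i) (b j) (len i) (len j) (b k) (len k)
                                                 (m+[n∸m]≡n A+B≤R) (b-subadditive i j)
                                                 (≤-trans (≤-reflexive (sym (b-suc k))) (b-subadditive-sucˡ i j))
                                                 (≤-trans (≤-reflexive (sym (b-suc k))) (b-subadditive-sucʳ i j)))) A+B≤R ⟩
            Ω (suc ((b i + α) + (b j + β))) ∎
          by-carry (no A+B≰R) with carry-split (δ*weight≤R α i α≤len) (δ*weight≤R β j β≤len) (<⇒≤ (≰⇒> A+B≰R))
          ... | A′ , B′ , E , eR , eA , eB = begin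
            Ω (b i + α) + Ω (b j + β)     ≡⟨ Ω-sum ⟩
            (R * i + A) + (R * j + B)     ≡⟨ carry-sum A′ B′ E i j eR eA eB ⟨
            R * suc k + E                 ≤⟨ Ω-lower-bound (suc k) _ E (subst (R * b (suc k) + E * len (suc k) ≤_) R*suc-sum
                                               (carry-lower A′ B′ E (b i) (b j) (len i) (len j) (b (suc k)) (len (suc k)) eR eA eB
                                                 (b-subadditive-sucʳ i j) (b-subadditive-sucˡ i j)
                                                 (≤-trans (≤-reflexive (sym (b-suc (suc k)))) (b-subadditive-suc² i j))))
                                               (subst (E ≤_) (sym eR) (m≤n+m E (A′ + B′))) ⟩
            Ω (suc ((b i + α) + (b j + β))) ∎

      Ω-subadditive : ∀ x t → Ω (x + t) ≤ Ω x + Ω t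
      Ω-subadditive x t with position x | position t
      ... | record { index = i ; offset = α ; offset≤len = α≤len ; b+offset≡x = refl }
          | record { index = j ; offset = β ; offset≤len = β≤len ; b+offset≡x = refl } =
        Ω-subadditive-by-position i α j β α≤len β≤len

      Ω-superadditive : ∀ x t → Ω x + Ω t ≤ Ω (suc (x + t))
      Ω-superadditive x t with position x | position t
      ... | record { index = i ; offset = α ; offset≤len = α≤len ; b+offset≡x = refl }
          | record { index = j ; offset = β ; offset≤len = β≤len ; b+offset≡x = refl } =
        Ω-superadditive-by-position i α j β α≤len β≤len

module Reflection (c h : ℕ) .{{_ : NonZero h}} .{{_ : NonZero c}} (w M : ℕ) (hM : h * M ≡ w * c + 1) where
  open Boundaries c h

  -- Since j c + (w − j) c = h M − 1, the remainders of j c and (w − j) c modulo h add up to h − 1.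
  b-reflect : ∀ j → j ≤ w → suc (b j + b (w ∸ j)) ≡ M
  b-reflect j j≤w = m*n+o≡p*n⇒1+m≡p (q + Q) h (suc (ρ + ρ′)) M eq z<s 1+ρ+ρ′<2h
    where
      open ≡-Reasoning
      q = b j
      Q = b (w ∸ j)
      ρ = (j * c) % h
      ρ′ = ((w ∸ j) * c) % h
      regroup : ∀ q Q h ρ ρ′ → (q + Q) * h + suc (ρ + ρ′) ≡ (ρ + q * h) + (ρ′ + Q * h) + 1
      regroup = solve-∀
      eq : (q + Q) * h + suc (ρ + ρ′) ≡ M * h
      eq = begin
        (q + Q) * h + suc (ρ + ρ′)       ≡⟨ regroup q Q h ρ ρ′ ⟩
        (ρ + q * h) + (ρ′ + Q * h) + 1   ≡⟨ cong₂ (λ u v → u + v + 1) (m≡m%n+[m/n]*n (j * c) h) (m≡m%n+[m/n]*n ((w ∸ j) * c) h) ⟨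
        j * c + (w ∸ j) * c + 1          ≡⟨ cong (_+ 1) (*-distribʳ-+ c j (w ∸ j)) ⟨
        (j + (w ∸ j)) * c + 1            ≡⟨ cong (λ z → z * c + 1) (m+[n∸m]≡n j≤w) ⟩
        w * c + 1                        ≡⟨ hM ⟨
        h * M                            ≡⟨ *-comm h M ⟩
        M * h                            ∎
      1+ρ+ρ′<2h : suc (ρ + ρ′) < h + h
      1+ρ+ρ′<2h = subst (_≤ h + h) (cong suc (+-suc ρ ρ′)) (+-mono-≤ (m%n<n (j * c) h) (m%n<n ((w ∸ j) * c) h))

  1+b[w]≡M : suc (b w) ≡ M
  1+b[w]≡M = trans (cong (λ z → suc (z + b w)) (sym (0/n≡0 h))) (b-reflect 0 z≤n)

  ω-reflect : ∀ x → x < b w → ω (M ∸ suc x) ≡ ω (suc x)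
  ω-reflect x x<bw = begin-equality
    ω u                    ≡⟨ ω-segment j′ lo′ hi′ ⟩
    weight j′              ≡⟨ cong (r + suc r ∸_) len-eq ⟩
    weight j               ∎
    where
      open ≤-Reasoning
      j = segment (suc x)
      lo = proj₁ (segment-bounds x)
      hi = proj₂ (segment-bounds x)
      j<w : j < w
      j<w = ≰⇒> (λ w≤j → <⇒≱ (<-≤-trans lo x<bw) (b-mono w≤j))
      j′ = w ∸ suc j
      M≡₁ : suc (b j + b (suc j′)) ≡ M
      M≡₁ = trans (cong (λ z → suc (b j + b z)) (sym (+-∸-assoc 1 j<w))) (b-reflect j (<⇒≤ j<w))
      M≡₂ : suc (b (suc j) + b j′) ≡ M
      M≡₂ = b-reflect (suc j) j<w
      u = M ∸ suc x
      u+1+x≡M : u + suc x ≡ M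
      u+1+x≡M = m∸n+n≡m (≤-trans (m≤n⇒m≤1+n x<bw) (≤-reflexive 1+b[w]≡M))
      lo′ : b j′ < u
      lo′ = +-cancelʳ-≤ (suc x) (suc (b j′)) u (begin
        suc (b j′) + suc x             ≤⟨ +-monoʳ-≤ (suc (b j′)) hi ⟩
        suc (b j′) + b (suc j)         ≡⟨ cong suc (+-comm (b j′) (b (suc j))) ⟩
        suc (b (suc j) + b j′)         ≡⟨ trans M≡₂ (sym u+1+x≡M) ⟩
        u + suc x                      ∎)
      hi′ : u ≤ b (suc j′)
      hi′ = +-cancelʳ-≤ (suc x) u (b (suc j′)) (begin
        u + suc x                      ≡⟨ trans u+1+x≡M (sym M≡₁) ⟩
        suc (b j + b (suc j′))         ≡⟨ +-comm (suc (b j)) (b (suc j′)) ⟩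
        b (suc j′) + suc (b j)         ≤⟨ +-monoʳ-≤ (b (suc j′)) lo ⟩
        b (suc j′) + suc x             ∎)
      len-eq : len j′ ≡ len j
      len-eq = +-cancelˡ-≡ (b j + b j′) _ _ (begin-equality
        b j + b j′ + len j′            ≡⟨ +-assoc (b j) (b j′) (len j′) ⟩
        b j + (b j′ + len j′)          ≡⟨ cong (b j +_) (b-suc j′) ⟨
        b j + b (suc j′)               ≡⟨ suc-injective (trans M≡₁ (sym M≡₂)) ⟩
        b (suc j) + b j′               ≡⟨ cong (_+ b j′) (b-suc j) ⟩
        b j + len j + b j′             ≡⟨ +-assoc (b j) (len j) (b j′) ⟩
        b j + (len j + b j′)           ≡⟨ cong (b j +_) (+-comm (len j) (b j′)) ⟩
        b j + (b j′ + len j)           ≡⟨ +-assoc (b j) (b j′) (len j) ⟨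
        b j + b j′ + len j             ∎)

  Ω-complement : ∀ p → p ≤ b w → Ω (b w ∸ p) + Ω p ≡ Ω (b w)
  Ω-complement zero _ = +-identityʳ _
  Ω-complement (suc p) 1+p≤bw = begin
    Ω (b w ∸ suc p) + (Ω p + ω (suc p))                  ≡⟨ cong (Ω (b w ∸ suc p) +_) (+-comm (Ω p) (ω (suc p))) ⟩
    Ω (b w ∸ suc p) + (ω (suc p) + Ω p)                  ≡⟨ +-assoc (Ω (b w ∸ suc p)) (ω (suc p)) (Ω p) ⟨
    Ω (b w ∸ suc p) + ω (suc p) + Ω p                    ≡⟨ cong (λ z → Ω (b w ∸ suc p) + z + Ω p) (ω-reflect p 1+p≤bw) ⟨
    Ω (b w ∸ suc p) + ω (M ∸ suc p) + Ω p                ≡⟨ cong (λ z → Ω (b w ∸ suc p) + ω (z ∸ suc p) + Ω p) 1+b[w]≡M ⟨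
    Ω (b w ∸ suc p) + ω (b w ∸ p) + Ω p                  ≡⟨ cong (λ z → Ω (b w ∸ suc p) + ω z + Ω p) (+-∸-assoc 1 1+p≤bw) ⟩
    Ω (suc (b w ∸ suc p)) + Ω p                          ≡⟨ cong (λ z → Ω z + Ω p) (+-∸-assoc 1 1+p≤bw) ⟨
    Ω (b w ∸ p) + Ω p                                    ≡⟨ Ω-complement p (<⇒≤ 1+p≤bw) ⟩
    Ω (b w)                                              ∎
    where open ≡-Reasoning

windowSum : (ℕ → ℕ) → ℕ → ℕ → ℕ
windowSum f a zero    = 0
windowSum f a (suc l) = f a + windowSum f (suc a) l

windowSum-++ : ∀ f a l l′ → windowSum f a (l + l′) ≡ windowSum f a l + windowSum f (a + l) l′
windowSum-++ f a zero    l′ = cong (λ z → windowSum f z l′) (sym (+-identityʳ a))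
windowSum-++ f a (suc l) l′ = begin
  f a + windowSum f (suc a) (l + l′)                            ≡⟨ cong (f a +_) (windowSum-++ f (suc a) l l′) ⟩
  f a + (windowSum f (suc a) l + windowSum f (suc a + l) l′)    ≡⟨ cong (λ z → f a + (windowSum f (suc a) l + windowSum f z l′)) (+-suc a l) ⟨
  f a + (windowSum f (suc a) l + windowSum f (a + suc l) l′)    ≡⟨ +-assoc (f a) _ _ ⟨
  f a + windowSum f (suc a) l + windowSum f (a + suc l) l′      ∎
  where open ≡-Reasoning

windowSum-shift : ∀ f a a′ l → (∀ i → f (a + i) ≡ f (a′ + i)) → windowSum f a l ≡ windowSum f a′ l
windowSum-shift f a a′ zero    _  = refl
windowSum-shift f a a′ (suc l) eq = cong₂ _+_
  (subst₂ (λ x y → f x ≡ f y) (+-identityʳ a) (+-identityʳ a′) (eq 0))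
  (windowSum-shift f (suc a) (suc a′) l (λ i → subst₂ (λ x y → f x ≡ f y) (+-suc a i) (+-suc a′ i) (eq (suc i))))

[m+n]%o≡[m%o+n]%o : ∀ m n o .{{_ : NonZero o}} → (m + n) % o ≡ (m % o + n) % o
[m+n]%o≡[m%o+n]%o m n o = begin
  (m + n) % o                         ≡⟨ cong (λ z → (z + n) % o) (m≡m%n+[m/n]*n m o) ⟩
  (m % o + m / o * o + n) % o         ≡⟨ cong (_% o) (+-assoc (m % o) _ n) ⟩
  (m % o + (m / o * o + n)) % o       ≡⟨ cong (λ z → (m % o + z) % o) (+-comm (m / o * o) n) ⟩
  (m % o + (n + m / o * o)) % o       ≡⟨ cong (_% o) (+-assoc (m % o) n _) ⟨
  (m % o + n + m / o * o) % o         ≡⟨ [m+kn]%n≡m%n (m % o + n) (m / o) o ⟩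
  (m % o + n) % o                     ∎
  where open ≡-Reasoning

windowSum-cong : ∀ {f g} a l → (∀ x → f x ≡ g x) → windowSum f a l ≡ windowSum g a l
windowSum-cong a zero    _  = refl
windowSum-cong a (suc l) eq = cong₂ _+_ (eq a) (windowSum-cong (suc a) l eq)

windowSum-distrib-+ : ∀ f g a l → windowSum (λ x → f x + g x) a l ≡ windowSum f a l + windowSum g a l
windowSum-distrib-+ f g a zero    = refl
windowSum-distrib-+ f g a (suc l) = trans (cong (f a + g a +_) (windowSum-distrib-+ f g (suc a) l))
                                          (+-interchange (f a) (g a) _ _)

windowSum-zero : ∀ a l → windowSum (λ _ → 0) a l ≡ 0
windowSum-zero a zero    = refl
windowSum-zero a (suc l) = windowSum-zero (suc a) l

point : ℕ → (ℕ → ℕ) → ℕ → ℕ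
point p f x = if p ≡ᵇ x then f x else 0

windowSum-point-before : ∀ p f a l → p < a → windowSum (point p f) a l ≡ 0
windowSum-point-before p f a zero    _   = refl
windowSum-point-before p f a (suc l) p<a
  rewrite dec-false (p ≟ a) (<⇒≢ p<a) = windowSum-point-before p f (suc a) l (m<n⇒m<1+n p<a)

windowSum-point : ∀ p f a l → a ≤ p → p < a + l → windowSum (point p f) a l ≡ f p
windowSum-point p f a zero    a≤p p<a+0 = ⊥-elim (<⇒≱ p<a+0 (subst (_≤ p) (sym (+-identityʳ a)) a≤p))
windowSum-point p f a (suc l) a≤p p<a+1+l with p ≟ a
... | yes refl rewrite dec-true (p ≟ p) refl = trans (cong (f p +_) (windowSum-point-before p f (suc p) l ≤-refl)) (+-identityʳ (f p))
... | no  p≢a  rewrite dec-false (p ≟ a) p≢a = windowSum-point p f (suc a) l (≤∧≢⇒< a≤p (p≢a ∘ sym)) (subst (p <_) (+-suc a l) p<a+1+l)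

module Windows (c h : ℕ) .{{_ : NonZero h}} .{{_ : NonZero c}} (w M : ℕ) (hM : h * M ≡ w * c + 1) where
  open Boundaries c h
  open Reflection c h w M hM

  B : ℕ
  B = b w

  instance
    M≢0 : NonZero M
    M≢0 = subst NonZero 1+b[w]≡M _

  ω% : ℕ → ℕ
  ω% x = ω (x % M)

  prefix : ℕ → ℕ
  prefix = windowSum ω% 0

  windowSum-% : ∀ a l → windowSum ω% a l ≡ windowSum ω% (a % M) l
  windowSum-% a l = windowSum-shift ω% a (a % M) l (λ i → cong ω ([m+n]%o≡[m%o+n]%o a i M))

  prefix+windowSum : ∀ x l → prefix x + windowSum ω% x l ≡ prefix (x + l)
  prefix+windowSum x l = sym (windowSum-++ ω% 0 x l)

  B<M : B < M
  B<M = ≤-reflexive 1+b[w]≡M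

  prefix-suc : ∀ x → x < M → prefix (suc x) ≡ Ω x
  prefix-suc zero    0<M   = trans (+-identityʳ _) (cong ω (m<n⇒m%n≡m 0<M))
  prefix-suc (suc x) 2+x<M = begin
    prefix (suc (suc x))              ≡⟨ cong prefix (+-comm 1 (suc x)) ⟩
    prefix (suc x + 1)                ≡⟨ windowSum-++ ω% 0 (suc x) 1 ⟩
    prefix (suc x) + (ω% (suc x) + 0) ≡⟨ cong₂ _+_ (prefix-suc x (<⇒≤ 2+x<M)) (trans (+-identityʳ _) (cong ω (m<n⇒m%n≡m 2+x<M))) ⟩
    Ω (suc x)                         ∎
    where open ≡-Reasoning

  prefix-wrap : ∀ q → prefix (M + q) ≡ Ω B + prefix q
  prefix-wrap q = begin
    prefix (M + q)                    ≡⟨ prefix+windowSum M q ⟨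
    prefix M + windowSum ω% M q       ≡⟨ cong₂ _+_ (trans (cong prefix (sym 1+b[w]≡M)) (prefix-suc B B<M))
                                                  (trans (windowSum-% M q) (cong (λ z → windowSum ω% z q) (n%n≡0 M))) ⟩
    Ω B + prefix q                    ∎
    where open ≡-Reasoning

  windowSum-within : ∀ x l → suc x + l ≤ M → Ω x + windowSum ω% (suc x) l ≡ Ω (x + l)
  windowSum-within x l fits = begin
    Ω x + windowSum ω% (suc x) l      ≡⟨ cong (_+ windowSum ω% (suc x) l) (prefix-suc x (m+n≤o⇒m≤o (suc x) fits)) ⟨
    prefix (suc x) + windowSum ω% (suc x) l ≡⟨ prefix+windowSum (suc x) l ⟩
    prefix (suc (x + l))              ≡⟨ prefix-suc (x + l) fits ⟩
    Ω (x + l)                         ∎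
    where open ≡-Reasoning

  wrap-length : ∀ x l q → x ≤ B → suc x + l ≡ M + q → (B ∸ x) + q ≡ l
  wrap-length x l q x≤B eq = +-cancelˡ-≡ (suc x) _ _ (begin
    suc x + ((B ∸ x) + q)             ≡⟨ cong suc (+-assoc x (B ∸ x) q) ⟨
    suc (x + (B ∸ x) + q)             ≡⟨ cong (λ z → suc (z + q)) (m+[n∸m]≡n x≤B) ⟩
    suc (B + q)                       ≡⟨ cong (_+ q) 1+b[w]≡M ⟩
    M + q                             ≡⟨ eq ⟨
    suc x + l                         ∎)
    where open ≡-Reasoning

  windowSum-wrap : ∀ x l q → x ≤ B → suc x + l ≡ M + q → windowSum ω% (suc x) l ≡ Ω (B ∸ x) + prefix q
  windowSum-wrap x l q x≤B eq = +-cancelˡ-≡ (Ω x) _ _ (begin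
    Ω x + windowSum ω% (suc x) l      ≡⟨ cong (_+ windowSum ω% (suc x) l) (prefix-suc x (<-≤-trans (s≤s x≤B) B<M)) ⟨
    prefix (suc x) + windowSum ω% (suc x) l ≡⟨ prefix+windowSum (suc x) l ⟩
    prefix (suc x + l)                ≡⟨ cong prefix eq ⟩
    prefix (M + q)                    ≡⟨ prefix-wrap q ⟩
    Ω B + prefix q                    ≡⟨ cong (_+ prefix q) (Ω-complement (B ∸ x) (m∸n≤m B x)) ⟨
    Ω (B ∸ (B ∸ x)) + Ω (B ∸ x) + prefix q ≡⟨ cong (λ z → Ω z + Ω (B ∸ x) + prefix q) (m∸[m∸n]≡n x≤B) ⟩
    Ω x + Ω (B ∸ x) + prefix q        ≡⟨ +-assoc (Ω x) _ _ ⟩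
    Ω x + (Ω (B ∸ x) + prefix q)      ∎)
    where open ≡-Reasoning

  module _ (r>0 : 0 < r) where

    Ω+prefix≤Ω : ∀ p q → p + q ≤ B → Ω p + prefix q ≤ Ω (p + q)
    Ω+prefix≤Ω p zero    _     = ≤-reflexive (trans (+-identityʳ (Ω p)) (cong Ω (sym (+-identityʳ p))))
    Ω+prefix≤Ω p (suc q) p+q<B = begin
      Ω p + prefix (suc q)     ≡⟨ cong (Ω p +_) (prefix-suc q (<-≤-trans (≤-trans (s≤s (m≤n+m q p)) p+q<B′) (<⇒≤ B<M))) ⟩
      Ω p + Ω q                ≤⟨ Ω-superadditive r>0 p q ⟩
      Ω (suc (p + q))          ≡⟨ cong Ω (+-suc p q) ⟨
      Ω (p + suc q)            ∎
      where
        open ≤-Reasoning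
        p+q<B′ : suc (p + q) ≤ B
        p+q<B′ = subst (_≤ B) (+-suc p q) p+q<B

    Ω≤Ω+prefix : ∀ p q s → p + q ≡ suc s → s ≤ B → Ω s ≤ Ω p + prefix q
    Ω≤Ω+prefix p zero    s p≡1+s _   = ≤-trans (Ω-mono (≤-trans (n≤1+n s) (≤-reflexive (trans (sym p≡1+s) (+-identityʳ p)))))
                                                (m≤m+n (Ω p) 0)
    Ω≤Ω+prefix p (suc q) s p+1+q≡1+s s≤B = begin
      Ω s                      ≡⟨ cong Ω p+q≡s ⟨
      Ω (p + q)                ≤⟨ Ω-subadditive r>0 p q ⟩
      Ω p + Ω q                ≡⟨ cong (Ω p +_) (prefix-suc q (≤-trans (s≤s (≤-trans (m≤n+m q p) (subst (_≤ B) (sym p+q≡s) s≤B))) B<M)) ⟨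
      Ω p + prefix (suc q)     ∎
      where
        open ≤-Reasoning
        p+q≡s : p + q ≡ s
        p+q≡s = suc-injective (trans (sym (+-suc p q)) p+1+q≡1+s)

    windowSum≤Ω : ∀ a s → s ≤ B → windowSum ω% a s ≤ Ω s
    windowSum≤Ω a s s≤B = subst (_≤ Ω s) (sym (windowSum-% a s)) (from (a % M) (m%n<n a M))
      where
        open ≤-Reasoning
        from : ∀ x → x < M → windowSum ω% x s ≤ Ω s
        from zero    _     = Ω+prefix≤Ω 0 s s≤B
        from (suc x) 1+x<M with suc x + s ≤? M
        ... | yes fits = +-cancelˡ-≤ (Ω x) _ _ (begin
          Ω x + windowSum ω% (suc x) s    ≡⟨ windowSum-within x s fits ⟩
          Ω (x + s)                       ≤⟨ Ω-subadditive r>0 x s ⟩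
          Ω x + Ω s                       ∎)
        ... | no overflow = begin
          windowSum ω% (suc x) s          ≡⟨ windowSum-wrap x s q x≤B wraps ⟩
          Ω (B ∸ x) + prefix q            ≤⟨ Ω+prefix≤Ω (B ∸ x) q (≤-trans (≤-reflexive (wrap-length x s q x≤B wraps)) s≤B) ⟩
          Ω ((B ∸ x) + q)                 ≡⟨ cong Ω (wrap-length x s q x≤B wraps) ⟩
          Ω s                             ∎
          where
            x≤B : x ≤ B
            x≤B = <⇒≤ (≤-pred (≤-trans 1+x<M (≤-reflexive (sym 1+b[w]≡M))))
            q = suc x + s ∸ M
            wraps : suc x + s ≡ M + q
            wraps = sym (m+[n∸m]≡n (<⇒≤ (≰⇒> overflow)))

    Ω≤windowSum : ∀ a s → s ≤ B → Ω s ≤ windowSum ω% a (suc s)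
    Ω≤windowSum a s s≤B = subst (Ω s ≤_) (sym (windowSum-% a (suc s))) (from (a % M) (m%n<n a M))
      where
        open ≤-Reasoning
        from : ∀ x → x < M → Ω s ≤ windowSum ω% x (suc s)
        from zero    _     = Ω≤Ω+prefix 0 (suc s) s refl s≤B
        from (suc x) 1+x<M with suc x + suc s ≤? M
        ... | yes fits = +-cancelˡ-≤ (Ω x) _ _ (begin
          Ω x + Ω s                       ≤⟨ Ω-superadditive r>0 x s ⟩
          Ω (suc (x + s))                 ≡⟨ cong Ω (+-suc x s) ⟨
          Ω (x + suc s)                   ≡⟨ windowSum-within x (suc s) fits ⟨
          Ω x + windowSum ω% (suc x) (suc s) ∎)
        ... | no overflow = begin
          Ω s                             ≤⟨ Ω≤Ω+prefix (B ∸ x) q s (wrap-length x (suc s) q x≤B wraps) s≤B ⟩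
          Ω (B ∸ x) + prefix q            ≡⟨ windowSum-wrap x (suc s) q x≤B wraps ⟨
          windowSum ω% (suc x) (suc s)    ∎
          where
            x≤B : x ≤ B
            x≤B = <⇒≤ (≤-pred (≤-trans 1+x<M (≤-reflexive (sym 1+b[w]≡M))))
            q = suc x + suc s ∸ M
            wraps : suc x + suc s ≡ M + q
            wraps = sym (m+[n∸m]≡n (<⇒≤ (≰⇒> overflow)))

    windowSum-merge : ∀ u ℓ v s → s ≤ B → windowSum ω% u ℓ + windowSum ω% v s ≤ windowSum ω% u (ℓ + s + 1)
    windowSum-merge u ℓ v s s≤B = begin
      windowSum ω% u ℓ + windowSum ω% v s              ≤⟨ +-monoʳ-≤ (windowSum ω% u ℓ) (windowSum≤Ω v s s≤B) ⟩
      windowSum ω% u ℓ + Ω s                           ≤⟨ +-monoʳ-≤ (windowSum ω% u ℓ) (Ω≤windowSum (u + ℓ) s s≤B) ⟩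
      windowSum ω% u ℓ + windowSum ω% (u + ℓ) (suc s)  ≡⟨ windowSum-++ ω% u ℓ (suc s) ⟨
      windowSum ω% u (ℓ + suc s)                       ≡⟨ cong (windowSum ω% u) (trans (cong (ℓ +_) (+-comm 1 s)) (sym (+-assoc ℓ s 1))) ⟩
      windowSum ω% u (ℓ + s + 1)                       ∎
      where open ≤-Reasoning

private
  toℚᵘ-frac : ∀ a d → toℚᵘ (frac a (suc d)) ℚᵘ.≃ mkℚᵘ (ℤ.+ a) d
  toℚᵘ-frac a d = ℚ.toℚᵘ-fromℚᵘ (mkℚᵘ (ℤ.+ a) d)

  cross-≤ : ∀ a d a′ d′ → a * suc d′ ≤ a′ * suc d → mkℚᵘ (ℤ.+ a) d ℚᵘ.≤ mkℚᵘ (ℤ.+ a′) d′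
  cross-≤ a d a′ d′ le = *≤* (subst₂ ℤ._≤_ (ℤ.pos-* a (suc d′)) (ℤ.pos-* a′ (suc d)) (ℤ.+≤+ le))

  cross-≤⁻ : ∀ a d a′ d′ → mkℚᵘ (ℤ.+ a) d ℚᵘ.≤ mkℚᵘ (ℤ.+ a′) d′ → a * suc d′ ≤ a′ * suc d
  cross-≤⁻ a d a′ d′ le = ℤ.drop‿+≤+ (subst₂ ℤ._≤_ (sym (ℤ.pos-* a (suc d′))) (sym (ℤ.pos-* a′ (suc d))) (ℚᵘ.drop-*≤* le))

  cross-≡ : ∀ a d a′ d′ → a * suc d′ ≡ a′ * suc d → mkℚᵘ (ℤ.+ a) d ℚᵘ.≃ mkℚᵘ (ℤ.+ a′) d′
  cross-≡ a d a′ d′ eq = *≡* (trans (sym (ℤ.pos-* a (suc d′))) (trans (cong ℤ.+_ eq) (ℤ.pos-* a′ (suc d))))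

  sum-identity : ∀ (x y z : ℤ) → (x ℤ.* z ℤ.+ y ℤ.* z) ℤ.* z ≡ (x ℤ.+ y) ℤ.* (z ℤ.* z)
  sum-identity = ℤ-Solver.solve-∀

frac-≤ : ∀ a d a′ d′ .{{_ : NonZero d}} .{{_ : NonZero d′}} → a * d′ ≤ a′ * d → frac a d ℚ.≤ frac a′ d′
frac-≤ a (suc d) a′ (suc d′) le = ℚ.toℚᵘ-cancel-≤
  (ℚᵘ.≤-respˡ-≃ (ℚᵘ.≃-sym (toℚᵘ-frac a d)) (ℚᵘ.≤-respʳ-≃ (ℚᵘ.≃-sym (toℚᵘ-frac a′ d′)) (cross-≤ a d a′ d′ le)))

frac-≤⁻ : ∀ a d a′ d′ .{{_ : NonZero d}} .{{_ : NonZero d′}} → frac a d ℚ.≤ frac a′ d′ → a * d′ ≤ a′ * d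
frac-≤⁻ a (suc d) a′ (suc d′) le =
  cross-≤⁻ a d a′ d′ (ℚᵘ.≤-respˡ-≃ (toℚᵘ-frac a d) (ℚᵘ.≤-respʳ-≃ (toℚᵘ-frac a′ d′) (ℚ.toℚᵘ-mono-≤ le)))

frac-cong : ∀ a d a′ d′ .{{_ : NonZero d}} .{{_ : NonZero d′}} → a * d′ ≡ a′ * d → frac a d ≡ frac a′ d′
frac-cong a (suc d) a′ (suc d′) eq = ℚ.fromℚᵘ-cong (cross-≡ a d a′ d′ eq)

frac-0 : ∀ d .{{_ : NonZero d}} → frac 0 d ≡ 0ℚ
frac-0 (suc d) = ℚ.0/n≡0 (suc d)

frac-+ : ∀ a b d .{{_ : NonZero d}} → frac a d ℚ.+ frac b d ≡ frac (a + b) d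
frac-+ a b (suc d) = begin
  p ℚ.+ q                      ≡⟨ ℚ.fromℚᵘ-toℚᵘ (p ℚ.+ q) ⟨
  fromℚᵘ (toℚᵘ (p ℚ.+ q))      ≡⟨ ℚ.fromℚᵘ-cong (ℚᵘ.≃-trans (ℚ.toℚᵘ-homo-+ p q)
                                    (ℚᵘ.≃-trans (ℚᵘ.+-cong (toℚᵘ-frac a d) (toℚᵘ-frac b d)) same-denominator)) ⟩
  frac (a + b) (suc d)         ∎
  where
    open ≡-Reasoning
    p = frac a (suc d)
    q = frac b (suc d)
    same-denominator : mkℚᵘ (ℤ.+ a) d ℚᵘ.+ mkℚᵘ (ℤ.+ b) d ℚᵘ.≃ mkℚᵘ (ℤ.+ (a + b)) d
    same-denominator = *≡* (trans (sum-identity (ℤ.+ a) (ℤ.+ b) (ℤ.+ suc d)) (cong₂ ℤ._*_ (sym (ℤ.pos-+ a b)) refl))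

sumℚ-applyUpTo : ∀ (φ : ℕ → ℚ) f d .{{_ : NonZero d}} a k → (∀ i → i < k → φ i ≡ frac (f (a + i)) d) →
  sumℚ (applyUpTo φ k) ≡ frac (windowSum f a k) d
sumℚ-applyUpTo φ f d a zero    _  = sym (frac-0 d)
sumℚ-applyUpTo φ f d a (suc k) eq = begin
  φ 0 ℚ.+ sumℚ (applyUpTo (φ ∘ suc) k)           ≡⟨ cong₂ ℚ._+_ (trans (eq 0 z<s) (cong (λ z → frac (f z) d) (+-identityʳ a)))
                                                      (sumℚ-applyUpTo (φ ∘ suc) f d (suc a) k
                                                        (λ i i<k → trans (eq (suc i) (s≤s i<k)) (cong (λ z → frac (f z) d) (+-suc a i)))) ⟩
  frac (f a) d ℚ.+ frac (windowSum f (suc a) k) d ≡⟨ frac-+ (f a) _ d ⟩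
  frac (f a + windowSum f (suc a) k) d           ∎
  where open ≡-Reasoning

sumℚ-range : ∀ (y : ℕ → ℚ) f d .{{_ : NonZero d}} k → (∀ i → 0 < i → i ≤ k → y i ≡ frac (f i) d) →
  sumℚ (map y (range 1 k)) ≡ frac (windowSum f 1 k) d
sumℚ-range y f d k eq = begin
  sumℚ (map y (range 1 k))                       ≡⟨ cong sumℚ (map-∘ (upTo k)) ⟨
  sumℚ (map (y ∘ suc) (upTo k))                  ≡⟨ cong sumℚ (map-upTo (y ∘ suc) k) ⟩
  sumℚ (applyUpTo (y ∘ suc) k)                   ≡⟨ sumℚ-applyUpTo (y ∘ suc) f d 1 k (λ i i<k → eq (suc i) z<s i<k) ⟩
  frac (windowSum f 1 k) d                       ∎
  where open ≡-Reasoning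

range≡applyUpTo : ∀ a len → range a len ≡ applyUpTo (a +_) len
range≡applyUpTo a len = map-applyUpTo (λ i → i) (a +_) len

any-applyUpTo-suc : ∀ (P : ℕ → Bool) f k → any P (applyUpTo f (suc k)) ≡ any P (applyUpTo f k) ∨ P (f k)
any-applyUpTo-suc P f zero    = Bool.∨-identityʳ (P (f 0))
any-applyUpTo-suc P f (suc k) = trans (cong (P (f 0) ∨_) (any-applyUpTo-suc P (f ∘ suc) k)) (sym (Bool.∨-assoc (P (f 0)) _ _))

any-applyUpTo-false : ∀ (P : ℕ → Bool) f k → (∀ i → i < k → P (f i) ≡ false) → any P (applyUpTo f k) ≡ false
any-applyUpTo-false P f zero    _   = refl
any-applyUpTo-false P f (suc k) all rewrite all 0 z<s = any-applyUpTo-false P (f ∘ suc) k (λ i i<k → all (suc i) (s≤s i<k))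

-- Parametrised by M − 1 so that modN z M, and hence inInterval M, computes with z % M.
module IntervalSums (M-1 : ℕ) where

  M : ℕ
  M = suc M-1

  shifted-residue-≢ : ∀ e d → e < M → 0 < d → d < M → e ≢ (e + d) % M
  shifted-residue-≢ e d e<M d>0 d<M eq with e + d <? M
  ... | yes e+d<M = <⇒≢ (m<m+n e d>0) (trans eq (m<n⇒m%n≡m e+d<M))
  ... | no  e+d≮M = <⇒≢ t<e (sym (trans eq (trans (cong (_% M) (sym t+M≡e+d)) (trans ([m+n]%n≡m%n t M) (m<n⇒m%n≡m t<M)))))
    where
      t = e + d ∸ M
      t+M≡e+d : t + M ≡ e + d
      t+M≡e+d = m∸n+n≡m (≮⇒≥ e+d≮M)
      t<e : t < e
      t<e = +-cancelʳ-< M t e (subst (_< e + M) (sym t+M≡e+d) (+-monoʳ-< e d<M))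
      t<M : t < M
      t<M = <-trans t<e e<M

  distinct-residues : ∀ a i len → i < len → len < M → (a + i) % M ≢ (a + len) % M
  distinct-residues a i len i<len len<M eq =
    shifted-residue-≢ ((a + i) % M) d (m%n<n (a + i) M) (m<n⇒0<n∸m i<len) (≤-<-trans (m∸n≤m len i) len<M)
      (trans eq (trans (cong (_% M) a+len≡a+i+d) ([m+n]%o≡[m%o+n]%o (a + i) d M)))
    where
      d = len ∸ i
      a+len≡a+i+d : a + len ≡ a + i + d
      a+len≡a+i+d = trans (cong (a +_) (sym (m+[n∸m]≡n (<⇒≤ i<len)))) (sym (+-assoc a i d))

  inInterval-suc : ∀ a len x → inInterval M a (suc len) x ≡ inInterval M a len x ∨ ((a + len) % M ≡ᵇ x)
  inInterval-suc a len x = begin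
    any P (range a (suc len))                ≡⟨ cong (any P) (range≡applyUpTo a (suc len)) ⟩
    any P (applyUpTo (a +_) (suc len))       ≡⟨ any-applyUpTo-suc P (a +_) len ⟩
    any P (applyUpTo (a +_) len) ∨ P (a + len) ≡⟨ cong (λ z → any P z ∨ P (a + len)) (range≡applyUpTo a len) ⟨
    any P (range a len) ∨ P (a + len)        ∎
    where
      open ≡-Reasoning
      P = λ z → modN z M ≡ᵇ x

  inInterval-next : ∀ a len → len < M → inInterval M a len ((a + len) % M) ≡ false
  inInterval-next a len len<M = trans (cong (any _) (range≡applyUpTo a len))
    (any-applyUpTo-false _ (a +_) len (λ i i<len → dec-false (_ ≟ _) (distinct-residues a i len i<len len<M)))

  inside : (ℕ → ℕ) → ℕ → ℕ → ℕ → ℕ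
  inside f a len x = if inInterval M a len x then f x else 0

  inside-suc : ∀ f a len → len < M → ∀ x → inside f a (suc len) x ≡ inside f a len x + point ((a + len) % M) f x
  inside-suc f a len len<M x rewrite inInterval-suc a len x with inInterval M a len x in old | (a + len) % M ≟ x
  ... | true  | yes refl with () ← trans (sym old) (inInterval-next a len len<M)
  ... | true  | no  p≢x rewrite dec-false ((a + len) % M ≟ x) p≢x = sym (+-identityʳ (f x))
  ... | false | yes refl rewrite dec-true ((a + len) % M ≟ (a + len) % M) refl = refl
  ... | false | no  p≢x rewrite dec-false ((a + len) % M ≟ x) p≢x = refl

  windowSum-inside : ∀ f a len → len ≤ M → windowSum (inside f a len) 0 M ≡ windowSum (f ∘ (_% M)) a len
  windowSum-inside f a zero    _       = windowSum-zero 0 M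
  windowSum-inside f a (suc len) 1+len≤M = begin
    windowSum (inside f a (suc len)) 0 M                               ≡⟨ windowSum-cong 0 M (inside-suc f a len 1+len≤M) ⟩
    windowSum (λ x → inside f a len x + point p f x) 0 M               ≡⟨ windowSum-distrib-+ (inside f a len) (point p f) 0 M ⟩
    windowSum (inside f a len) 0 M + windowSum (point p f) 0 M         ≡⟨ cong₂ _+_ (windowSum-inside f a len (<⇒≤ 1+len≤M))
                                                                            (windowSum-point p f 0 M z≤n (m%n<n (a + len) M)) ⟩
    windowSum (f ∘ (_% M)) a len + f p                                 ≡⟨ cong (windowSum (f ∘ (_% M)) a len +_) (+-identityʳ (f p)) ⟨
    windowSum (f ∘ (_% M)) a len + windowSum (f ∘ (_% M)) (a + len) 1  ≡⟨ windowSum-++ (f ∘ (_% M)) a len 1 ⟨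
    windowSum (f ∘ (_% M)) a (len + 1)                                 ≡⟨ cong (windowSum (f ∘ (_% M)) a) (+-comm len 1) ⟩
    windowSum (f ∘ (_% M)) a (suc len)                                 ∎
    where
      open ≡-Reasoning
      p = (a + len) % M

  yInterval-frac : ∀ (y : ℕ → ℚ) f d .{{_ : NonZero d}} → (∀ x → x < M → y x ≡ frac (f x) d) →
    ∀ a len → len ≤ M → yInterval y M a len ≡ frac (windowSum (f ∘ (_% M)) a len) d
  yInterval-frac y f d y≡ a len len≤M = begin
    sumℚ (map F (upTo M))                        ≡⟨ cong sumℚ (map-upTo F M) ⟩
    sumℚ (applyUpTo F M)                         ≡⟨ sumℚ-applyUpTo F (inside f a len) d 0 M F≡ ⟩
    frac (windowSum (inside f a len) 0 M) d      ≡⟨ cong (λ z → frac z d) (windowSum-inside f a len len≤M) ⟩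
    frac (windowSum (f ∘ (_% M)) a len) d        ∎
    where
      open ≡-Reasoning
      F : ℕ → ℚ
      F x = if inInterval M a len x then y x else 0ℚ
      F≡ : ∀ x → x < M → F x ≡ frac (inside f a len x) d
      F≡ x x<M with inInterval M a len x
      ... | true  = y≡ x x<M
      ... | false = sym (frac-0 d)

module SegmentConstruction (n-2 h-1 w c : ℕ) .{{_ : NonZero w}} .{{_ : NonZero c}}
                           (hM : suc h-1 * suc n-2 ≡ w * c + 1) where

  n M h : ℕ
  n = suc (suc n-2)
  M = suc n-2
  h = suc h-1

  open Boundaries c h
  open Reflection c h w M hM
  open Windows c h w M hM using (B; ω%; windowSum-merge)
  open IntervalSums n-2 using (yInterval-frac)

  b[w]≡n-2 : b w ≡ n-2
  b[w]≡n-2 = suc-injective 1+b[w]≡M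

  -- The local definitions of segLoop; a loop step unfolds to them definitionally, since
  -- h = suc h-1 makes rOf h c compute to r.
  mass : (ℕ → ℚ) → ℕ → ℚ
  mass y v = sumℚ (map y (range 1 (v ∸ 1)))

  rstar : (ℕ → ℚ) → ℕ → ℕ
  rstar y v = if does (g h w c (v + suc r ∸ 1) ℚ.≤? (mass y v ℚ.+ frac 1 w)) then suc r else r

  fill : (ℕ → ℚ) → ℕ → ℕ → ℚ
  fill y v i = if (v ≤ᵇ i) ∧ (i <ᵇ (v + rstar y v)) ∧ (i <ᵇ n) then frac 1 (rstar y v * w) else y i

  instance
    w*c≢0 : NonZero (w * c)
    w*c≢0 = m*n≢0 w c

  h≤c : w ≤ n-2 → h ≤ c
  h≤c w≤n-2 = ≮⇒≥ (λ c<h → <-irrefl (sym hM) (begin-strict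
    w * c + 1                 ≤⟨ +-monoˡ-≤ 1 (*-monoˡ-≤ c w≤n-2) ⟩
    n-2 * c + 1               <⟨ m<m+n (n-2 * c + 1) (≤-trans (>-nonZero⁻¹ c) (m≤m+n c n-2)) ⟩
    n-2 * c + 1 + (c + n-2)   ≡⟨ expand n-2 c ⟩
    suc c * M                 ≤⟨ *-monoˡ-≤ M c<h ⟩
    h * M                     ∎))
    where
      open ≤-Reasoning
      expand : ∀ m c → m * c + 1 + (c + m) ≡ suc c * suc m
      expand = solve-∀

  r-positive : w ≤ n-2 → 0 < r
  r-positive w≤n-2 = m≥n⇒m/n>0 (h≤c w≤n-2)

  module _ (r>0 : 0 < r) where

    instance
      R*w≢0 : NonZero (R * w)
      R*w≢0 = m*n≢0 R w {{R≢0 r>0}}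

    Y : ℕ → ℚ
    Y x = frac (ω x) (R * w)

    Agrees : ℕ → (ℕ → ℚ) → Set
    Agrees j y = (∀ x → x ≤ b j → y x ≡ Y x) × (∀ x → b j < x → y x ≡ 0ℚ)

    windowSum-ω : ∀ k → windowSum ω 1 k ≡ Ω k
    windowSum-ω zero    = refl
    windowSum-ω (suc k) = begin
      windowSum ω 1 (suc k)           ≡⟨ cong (windowSum ω 1) (+-comm 1 k) ⟩
      windowSum ω 1 (k + 1)           ≡⟨ windowSum-++ ω 1 k 1 ⟩
      windowSum ω 1 k + (ω (suc k) + 0) ≡⟨ cong₂ _+_ (windowSum-ω k) (+-identityʳ _) ⟩
      Ω (suc k)                       ∎
      where open ≡-Reasoning

    mass+1/w : ∀ j y → Agrees j y → mass y (suc (b j)) ℚ.+ frac 1 w ≡ frac (R * suc j) (R * w)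
    mass+1/w j y (y≡Y , _) = begin
      mass y (suc (b j)) ℚ.+ frac 1 w               ≡⟨ cong₂ ℚ._+_ (sumℚ-range y ω (R * w) (b j) (λ i _ i≤bj → y≡Y i i≤bj))
                                                         (frac-cong 1 w R (R * w) (*-identityˡ (R * w))) ⟩
      frac (windowSum ω 1 (b j)) (R * w) ℚ.+ frac R (R * w) ≡⟨ frac-+ (windowSum ω 1 (b j)) R (R * w) ⟩
      frac (windowSum ω 1 (b j) + R) (R * w)         ≡⟨ cong (λ z → frac (z + R) (R * w)) (trans (windowSum-ω (b j)) (Ω-boundary j)) ⟩
      frac (R * j + R) (R * w)                       ≡⟨ cong (λ z → frac z (R * w)) (trans (+-comm (R * j) R) (sym (*-suc R j))) ⟩
      frac (R * suc j) (R * w)                       ∎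
      where open ≡-Reasoning

    private
      scale : ∀ R j w c → R * suc j * (w * c) ≡ suc j * c * (R * w)
      scale = solve-∀

    threshold-sound : ∀ j → b j + suc r ≤ b (suc j) → g h w c (b j + suc r) ℚ.≤ frac (R * suc j) (R * w)
    threshold-sound j le = frac-≤ ((b j + suc r) * h) (w * c) (R * suc j) (R * w)
      (subst ((b j + suc r) * h * (R * w) ≤_) (sym (scale R j w c)) (*-monoˡ-≤ (R * w) (m≤o/n⇒m*n≤o {o = suc j * c} h le)))

    threshold-complete : ∀ j → g h w c (b j + suc r) ℚ.≤ frac (R * suc j) (R * w) → b j + suc r ≤ b (suc j)
    threshold-complete j le = m*n≤o⇒m≤o/n h (*-cancelʳ-≤ ((b j + suc r) * h) (suc j * c) (R * w)
      (subst ((b j + suc r) * h * (R * w) ≤_) (scale R j w c) (frac-≤⁻ ((b j + suc r) * h) (w * c) (R * suc j) (R * w) le)))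

    rstar-boundary : ∀ j y → Agrees j y → rstar y (suc (b j)) ≡ len j
    rstar-boundary j y agrees with len≡r⊎1+r j
    ... | inj₁ len≡r = trans (cong (λ t → if t then suc r else r) (dec-false (G ℚ.≤? mass′) (λ G≤ → 1+n≰n (begin
          suc (b j + r)     ≡⟨ +-suc (b j) r ⟨
          b j + suc r       ≤⟨ threshold-complete j (subst (G ℚ.≤_) (mass+1/w j y agrees) G≤) ⟩
          b (suc j)         ≡⟨ b-suc j ⟩
          b j + len j       ≡⟨ cong (b j +_) len≡r ⟩
          b j + r           ∎)))) (sym len≡r)
      where
        open ≤-Reasoning
        G = g h w c (b j + suc r)
        mass′ = mass y (suc (b j)) ℚ.+ frac 1 w
    ... | inj₂ len≡1+r = trans (cong (λ t → if t then suc r else r) (dec-true (G ℚ.≤? mass′)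
          (subst (G ℚ.≤_) (sym (mass+1/w j y agrees)) (threshold-sound j
            (≤-reflexive (sym (trans (b-suc j) (cong (b j +_) len≡1+r)))))))) (sym len≡1+r)
      where
        G = g h w c (b j + suc r)
        mass′ = mass y (suc (b j)) ℚ.+ frac 1 w

    next-start : ∀ j y → Agrees j y → suc (b j) + rstar y (suc (b j)) ≡ suc (b (suc j))
    next-start j y agrees = cong suc (trans (cong (b j +_) (rstar-boundary j y agrees)) (sym (b-suc j)))

    private
      ≤ᵇ-true : ∀ {i j} → i ≤ j → (i ≤ᵇ j) ≡ true
      ≤ᵇ-true {i} {j} = dec-true (i ≤? j)

      ≤ᵇ-false : ∀ {i j} → ¬ i ≤ j → (i ≤ᵇ j) ≡ false
      ≤ᵇ-false {i} {j} = dec-false (i ≤? j)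

      <ᵇ-true : ∀ {i j} → i < j → (i <ᵇ j) ≡ true
      <ᵇ-true {i} {j} = dec-true (i <? j)

      <ᵇ-false : ∀ {i j} → ¬ i < j → (i <ᵇ j) ≡ false
      <ᵇ-false {i} {j} = dec-false (i <? j)

    fill-before : ∀ y v i → i < v → fill y v i ≡ y i
    fill-before y v i i<v rewrite ≤ᵇ-false (<⇒≱ i<v) = refl

    fill-after : ∀ y v i → v + rstar y v ≤ i → fill y v i ≡ y i
    fill-after y v i ≤i rewrite ≤ᵇ-true (≤-trans (m≤m+n v (rstar y v)) ≤i) | <ᵇ-false (≤⇒≯ ≤i) = refl

    fill-inside : ∀ y v i → v ≤ i → i < v + rstar y v → i < n → fill y v i ≡ frac 1 (rstar y v * w)
    fill-inside y v i v≤i i< i<n rewrite ≤ᵇ-true v≤i | <ᵇ-true i< | <ᵇ-true i<n = refl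

    b-strict : ∀ {i j} → i < j → b i < b j
    b-strict {i} {j} i<j = begin-strict
      b i              <⟨ m<m+n (b i) r>0 ⟩
      b i + r          ≤⟨ +-monoʳ-≤ (b i) (r≤len i) ⟩
      b i + len i      ≡⟨ b-suc i ⟨
      b (suc i)        ≤⟨ b-mono i<j ⟩
      b j              ∎
      where open ≤-Reasoning

    agrees-step : ∀ j y → j < w → Agrees j y → Agrees (suc j) (fill y (suc (b j)))
    agrees-step j y j<w (y≡Y , y≡0) = agree , vanish
      where
        v = suc (b j)
        v+rstar≡ : v + rstar y v ≡ suc (b (suc j))
        v+rstar≡ = next-start j y (y≡Y , y≡0)
        agree-at : ∀ x → x ≤ b (suc j) → Dec (x ≤ b j) → fill y v x ≡ Y x
        agree-at x _ (yes x≤bj) = trans (fill-before y v x (s≤s x≤bj)) (y≡Y x x≤bj)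
        agree-at x x≤b[1+j] (no x≰bj) = begin
          fill y v x                 ≡⟨ fill-inside y v x (≰⇒> x≰bj) (subst (x <_) (sym v+rstar≡) (s≤s x≤b[1+j])) x<n ⟩
          frac 1 (rstar y v * w)     ≡⟨ cong (λ l → frac 1 (l * w)) (rstar-boundary j y (y≡Y , y≡0)) ⟩
          frac 1 (len j * w)         ≡⟨ frac-cong 1 (len j * w) (ω x) (R * w) {{m*n≢0 (len j) w {{>-nonZero (len>0 r>0 j)}}}} weights ⟩
          Y x                        ∎
          where
            open ≡-Reasoning
            x<n : x < n
            x<n = s≤s (≤-trans x≤b[1+j] (≤-trans (b-mono j<w) (≤-trans (≤-reflexive b[w]≡n-2) (n≤1+n n-2))))
            ωx≡ : ω x ≡ weight j
            ωx≡ = ω-segment j (≰⇒> x≰bj) x≤b[1+j]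
            weights : 1 * (R * w) ≡ ω x * (len j * w)
            weights = begin
              1 * (R * w)                  ≡⟨ *-identityˡ (R * w) ⟩
              R * w                        ≡⟨ cong (_* w) (len*weight≡R j) ⟨
              len j * weight j * w         ≡⟨ cong (_* w) (*-comm (len j) (weight j)) ⟩
              weight j * len j * w         ≡⟨ *-assoc (weight j) (len j) w ⟩
              weight j * (len j * w)       ≡⟨ cong (_* (len j * w)) ωx≡ ⟨
              ω x * (len j * w)            ∎
        agree : ∀ x → x ≤ b (suc j) → fill y v x ≡ Y x
        agree x x≤b[1+j] = agree-at x x≤b[1+j] (x ≤? b j)
        vanish : ∀ x → b (suc j) < x → fill y v x ≡ 0ℚ
        vanish x b[1+j]<x = trans (fill-after y v x (subst (_≤ x) (sym v+rstar≡) b[1+j]<x))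
                                  (y≡0 x (≤-<-trans (b-mono (n≤1+n j)) b[1+j]<x))

    segLoop-agrees : ∀ f j y → j ≤ w → w < j + f → Agrees j y → ∀ x → x < M → segLoop n h w c f (suc (b j)) y x ≡ Y x
    segLoop-agrees zero    j y j≤w w<j+0 _ _ _ = ⊥-elim (<⇒≱ w<j+0 (subst (_≤ w) (sym (+-identityʳ j)) j≤w))
    segLoop-agrees (suc f) j y j≤w w<j+1+f agrees x x<M with m≤n⇒m<n∨m≡n j≤w
    ... | inj₂ refl rewrite <ᵇ-true (s≤s (≤-reflexive (sym b[w]≡n-2))) =
      proj₁ agrees x (subst (x ≤_) (sym b[w]≡n-2) (≤-pred x<M))
    ... | inj₁ j<w rewrite <ᵇ-false (≤⇒≯ (subst (b j <_) b[w]≡n-2 (b-strict j<w))) = begin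
      segLoop n h w c f (suc (b j) + rstar y (suc (b j))) (fill y (suc (b j))) x
        ≡⟨ cong (λ v → segLoop n h w c f v (fill y (suc (b j))) x) (next-start j y agrees) ⟩
      segLoop n h w c f (suc (b (suc j))) (fill y (suc (b j))) x
        ≡⟨ segLoop-agrees f (suc j) (fill y (suc (b j))) j<w (subst (w <_) (+-suc j f) w<j+1+f) (agrees-step j y j<w agrees) x x<M ⟩
      Y x ∎
      where open ≡-Reasoning

    segY-agrees : w ≤ n-2 → ∀ x → x < M → segY n h w c x ≡ Y x
    segY-agrees w≤n-2 = segLoop-agrees n 0 (λ _ → 0ℚ) z≤n (s≤s (m≤n⇒m≤1+n w≤n-2))
      ((λ { zero _ → sym (frac-0 (R * w)) }) , (λ _ _ → refl))

    yInterval-segY : w ≤ n-2 → ∀ a len → len ≤ M → yInterval (segY n h w c) M a len ≡ frac (windowSum ω% a len) (R * w)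
    yInterval-segY w≤n-2 = yInterval-frac (segY n h w c) ω (R * w) (segY-agrees w≤n-2)

    yInterval-merge : w ≤ n-2 → c < n-2 → ∀ u ℓ v s → ℓ + s ≤ c →
      yInterval (segY n h w c) M u ℓ ℚ.+ yInterval (segY n h w c) M v s ℚ.≤ yInterval (segY n h w c) M u (ℓ + s + 1)
    yInterval-merge w≤n-2 c<n-2 u ℓ v s ℓ+s≤c = subst₂ ℚ._≤_
      (sym (trans (cong₂ ℚ._+_ (yInterval-segY w≤n-2 u ℓ (≤-trans (m≤m+n ℓ s) ℓ+s≤M))
                               (yInterval-segY w≤n-2 v s (≤-trans (m≤n+m s ℓ) ℓ+s≤M)))
                  (frac-+ (windowSum ω% u ℓ) (windowSum ω% v s) (R * w))))
      (sym (yInterval-segY w≤n-2 u (ℓ + s + 1) (subst (_≤ M) (+-comm 1 (ℓ + s)) (s≤s (≤-trans ℓ+s≤c (<⇒≤ c<n-2))))))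
      (frac-≤ _ (R * w) _ (R * w) (*-monoˡ-≤ (R * w) (windowSum-merge r>0 u ℓ v s s≤B)))
      where
        ℓ+s≤M : ℓ + s ≤ M
        ℓ+s≤M = ≤-trans ℓ+s≤c (≤-trans (<⇒≤ c<n-2) (n≤1+n n-2))
        s≤B : s ≤ B
        s≤B = subst (s ≤_) (sym b[w]≡n-2) (≤-trans (m≤n+m s ℓ) (≤-trans ℓ+s≤c (<⇒≤ c<n-2)))

m≡2^k∸2⇒m+2≡2^k : ∀ k m → 2 ≤ k → m ≡ 2 ^ k ∸ 2 → m + 2 ≡ 2 ^ k
m≡2^k∸2⇒m+2≡2^k k m 2≤k refl = m∸n+n≡m (≤-trans (s≤s (s≤s z≤n)) (^-monoʳ-≤ 2 2≤k))

lemma3p9 : (k n c h w : ℕ) → 2 ≤ k → 2 ^ k < n → c ≡ 2 ^ k ∸ 2 →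
    Coprime c (n ∸ 1) →
    0 < h → 0 < w → w ≤ n ∸ 2 → h * (n ∸ 1) ≡ w * c + 1 →
    ((h′ w′ : ℕ) → 0 < h′ → 0 < w′ → w′ ≤ n ∸ 2 → h′ * (n ∸ 1) ≡ w′ * c + 1 → w ≤ w′) →
    (u ℓ v s : ℕ) → ℓ + s ≤ c →
    ((x : ℕ) → ¬ (inInterval (n ∸ 1) u ℓ x ≡ true × inInterval (n ∸ 1) v s x ≡ true)) →
    yInterval (segY n h w c) (n ∸ 1) u ℓ +q yInterval (segY n h w c) (n ∸ 1) v s
      ≤q yInterval (segY n h w c) (n ∸ 1) u (ℓ + s + 1)
lemma3p9 k zero            c h         w 2≤k ()
lemma3p9 k (suc zero)      c h         w 2≤k (s≤s 2^k≤0) = ⊥-elim (<⇒≱ (m^n>0 2 k) 2^k≤0)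
lemma3p9 k (suc (suc n-2)) c zero      w 2≤k 2^k<n c≡ _ ()
lemma3p9 k (suc (suc n-2)) c (suc h-1) w 2≤k 2^k<n c≡ _ _ 0<w w≤n-2 hM _ u ℓ v s ℓ+s≤c _ =
  yInterval-merge (r-positive w≤n-2) w≤n-2 c<n-2 u ℓ v s ℓ+s≤c
  where
    c+2≡2^k : c + 2 ≡ 2 ^ k
    c+2≡2^k = m≡2^k∸2⇒m+2≡2^k k c 2≤k c≡
    c<n-2 : c < n-2
    c<n-2 = +-cancelʳ-< 2 c n-2 (subst (_< n-2 + 2) (sym c+2≡2^k) (subst (2 ^ k <_) (+-comm 2 n-2) 2^k<n))
    2≤c : 2 ≤ c
    2≤c = +-cancelʳ-≤ 2 2 c (subst (4 ≤_) (sym c+2≡2^k) (^-monoʳ-≤ 2 2≤k))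
    open SegmentConstruction n-2 h-1 w c {{>-nonZero 0<w}} {{>-nonZero (≤-trans (s≤s z≤n) 2≤c)}} hM
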